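{- Let $\Bbbk$ be a field of characteristic zero, $N$ a positive integer, $M=\bigoplus_{k\in\frac{1}{N}\mathbb{Z}}M_k$ a graded algebra of type $\frac{1}{N}\mathbb{Z}$ over $\Bbbk$, $\partial$ a derivation of $M$ of degree $2$, and $\mathcal{E}_4\in M_4$. Let $\widetilde{M}=M[\mathcal{E}_2]$ (polynomial ring, $\mathcal{E}_2$ of degree $2$) and let $\mathscr{D}$ be the derivation of $\widetilde{M}$ with $\mathscr{D}(f)=\partial f+k\,\mathcal{E}_2 f$ for $f\in M_k$ and $\mathscr{D}(\mathcal{E}_2)=\mathcal{E}_4+\mathcal{E}_2^2$. Define $\Psi_0:=0$, $\Psi_1:=\mathcal{E}_4$, and $\Psi_{j+1}:=\partial\Psi_j+j(j+1)\mathcal{E}_4\Psi_{j-1}$ for $j\ge1$. Then for every integer $n\ge0$, $$\mathscr{D}^{n+1}\mathcal{E}_2=\sum_{j=0}^{n+1}\frac{(n+1)!\,(n+2)!}{j!\,(j+1)!\,(n+1-j)!}\,\mathcal{E}_2^{\,n+1-j}\,\Psi_j+(n+1)!\,\mathcal{E}_2^{\,n+2}.$$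
   Context: A graded algebra of type $\frac{1}{N}\mathbb{Z}$ over $\Bbbk$ is a commutative, associative $\Bbbk$-algebra with unit $M=\bigoplus_{k\in\frac{1}{N}\mathbb{Z}}M_k$ with $M_kM_l\subseteq M_{k+l}$, $1\in M_0$, $\dim_\Bbbk M_k<\infty$. A degree-$2$ derivation maps $M_k$ into $M_{k+2}$; $\mathscr{D}^j$ is the $j$-th iterate of $\mathscr{D}$. Note $\Psi_j\in M$ since $\partial$ and $\mathcal{E}_4$ lie in/act on $M$. -}

module Defs where

open import Level using (Level; _⊔_) renaming (suc to lsuc)
open import Algebra.Bundles using (CommutativeRing; RawRing)
open import Algebra.Morphism.Structures using (module RingMorphisms)
import Algebra.Definitions.RawSemiring as RawSemiringDefs
open import Data.Nat as ℕ using (ℕ; zero; suc; _!; _∸_)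
open import Data.Nat.Properties using (m*n≢0; _!≢0)
open import Data.Integer as ℤ using (ℤ; +_; -[1+_])
open import Data.List using (List; []; _∷_)
open import Data.List.Relation.Unary.All using (All)
open import Data.List.Relation.Unary.AllPairs using (AllPairs)
open import Data.Vec using (Vec; []; _∷_)
import Data.Vec.Relation.Unary.All
open import Data.Product using (Σ; ∃; _,_; proj₁; proj₂) renaming (_×_ to _×ₚ_)
open import Relation.Nullary using (¬_)
open import Data.Nat.GeneralisedArithmetic using (iterate)
open import Relation.Binary.PropositionalEquality using (_≡_; _≢_)

private variable c ℓ c₁ ℓ₁ c₂ ℓ₂ c₃ ℓ₃ : Level

module RingOps (R : CommutativeRing c ℓ) where
  open CommutativeRing R
  open RawSemiringDefs (RawRing.rawSemiring rawRing) public using (_×_; _^_)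

  intR : ℤ → Carrier
  intR (+ n)      = n × 1#
  intR -[1+ n ]   = - (suc n × 1#)

  sum≤ : ℕ → (ℕ → Carrier) → Carrier
  sum≤ zero    f = f 0
  sum≤ (suc n) f = sum≤ n f + f (suc n)

  sumL : List Carrier → Carrier
  sumL []       = 0#
  sumL (x ∷ xs) = x + sumL xs

IsRingHom : (R : CommutativeRing c₁ ℓ₁) (S : CommutativeRing c₂ ℓ₂) →
            (CommutativeRing.Carrier R → CommutativeRing.Carrier S) → Set _
IsRingHom R S f =
  RingMorphisms.IsRingHomomorphism (CommutativeRing.rawRing R) (CommutativeRing.rawRing S) f

record Field c ℓ : Set (lsuc (c ⊔ ℓ)) where
  field
    commutativeRing : CommutativeRing c ℓ
  open CommutativeRing commutativeRing public
  open RingOps commutativeRing public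
  field
    0≉1     : ¬ (0# ≈ 1#)
    inverse : ∀ x → ¬ (x ≈ 0#) → ∃ λ y → x * y ≈ 1#

CharacteristicZero : Field c ℓ → Set ℓ
CharacteristicZero K = ∀ n → ¬ (suc n × 1# ≈ 0#)
  where open Field K

record CommAlgebra (K : Field c₁ ℓ₁) c ℓ : Set (lsuc (c₁ ⊔ ℓ₁ ⊔ c ⊔ ℓ)) where
  field
    cring : CommutativeRing c ℓ
  open CommutativeRing cring public
  open RingOps cring public
  field
    η       : Field.Carrier K → Carrier
    η-isHom : IsRingHom (Field.commutativeRing K) cring η

  infixr 7 _·_
  _·_ : Field.Carrier K → Carrier → Carrier
  a · x = η a * x

  lincomb : ∀ {d} → Vec (Field.Carrier K) d → Vec Carrier d → Carrier
  lincomb []       []       = 0#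
  lincomb (a ∷ as) (b ∷ bs) = a · b + lincomb as bs

-- Graded algebra of type (1/N)ℤ over 𝕜.
-- The homogeneous component M_{m/N} (m ∈ ℤ) is the predicate  Gr m.

record GradedAlgebra (K : Field c₁ ℓ₁) (N : ℕ) c ℓ ℓg
       : Set (lsuc (c₁ ⊔ ℓ₁ ⊔ c ⊔ ℓ ⊔ ℓg)) where
  field
    algebra : CommAlgebra K c ℓ
  open CommAlgebra algebra public
  field
    Gr      : ℤ → Carrier → Set ℓg
    Gr-resp : ∀ {m x y} → x ≈ y → Gr m x → Gr m y
    Gr-0    : ∀ {m} → Gr m 0#
    Gr-+    : ∀ {m x y} → Gr m x → Gr m y → Gr m (x + y)
    Gr-·    : ∀ {m x} a → Gr m x → Gr m (a · x)
    Gr-*    : ∀ {m n x y} → Gr m x → Gr n y → Gr (m ℤ.+ n) (x * y)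
    Gr-1    : Gr (+ 0) 1#
    decomp  : ∀ x → ∃ λ (cs : List (ℤ ×ₚ Carrier)) →
                All (λ p → Gr (proj₁ p) (proj₂ p)) cs ×ₚ
                sumL (Data.List.map proj₂ cs) ≈ x
    direct  : ∀ (cs : List (ℤ ×ₚ Carrier)) →
                AllPairs (λ p q → proj₁ p ≢ proj₁ q) cs →
                All (λ p → Gr (proj₁ p) (proj₂ p)) cs →
                sumL (Data.List.map proj₂ cs) ≈ 0# →
                All (λ p → proj₂ p ≈ 0#) cs
    finDim  : ∀ m → ∃ λ d → Σ (Vec Carrier d) λ bs →
                Data.Vec.Relation.Unary.All.All (Gr m) bs ×ₚ
                (∀ y → Gr m y → ∃ λ (as : Vec (Field.Carrier K) d) → y ≈ lincomb as bs)

record IsDerivation {K : Field c₁ ℓ₁} (R : CommutativeRing c ℓ)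
                    (s : Field.Carrier K → CommutativeRing.Carrier R)
                    (∂ : CommutativeRing.Carrier R → CommutativeRing.Carrier R)
                    : Set (c₁ ⊔ c ⊔ ℓ) where
  open CommutativeRing R
  field
    cong     : ∀ {x y} → x ≈ y → ∂ x ≈ ∂ y
    additive : ∀ x y → ∂ (x + y) ≈ ∂ x + ∂ y
    linear   : ∀ a x → ∂ (s a * x) ≈ s a * ∂ x
    leibniz  : ∀ x y → ∂ (x * y) ≈ ∂ x * y + x * ∂ y

-- derivation of degree 2 of a graded algebra of type (1/N)ℤ:
-- maps M_{m/N} into M_{m/N + 2} = M_{(m + 2N)/N}
record IsDerivationOfDegree2 {K : Field c₁ ℓ₁} {N : ℕ} {ℓg}
                             (M : GradedAlgebra K N c ℓ ℓg)
                             (∂ : GradedAlgebra.Carrier M → GradedAlgebra.Carrier M)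
                             : Set (c₁ ⊔ c ⊔ ℓ ⊔ ℓg) where
  open GradedAlgebra M
  field
    isDerivation : IsDerivation {K = K} cring η ∂
    degree2      : ∀ {m x} → Gr m x → Gr (m ℤ.+ + (2 ℕ.* N)) (∂ x)

-- The polynomial ring  M̃ = M[E₂]:  a commutative ring T with a ring
-- homomorphism ι : M → T (constants) and an element E₂ such that every
-- element of T is uniquely Σ_i ι(a_i) E₂^i.

module _ (M : CommutativeRing c₁ ℓ₁) (T : CommutativeRing c₂ ℓ₂)
         (ι : CommutativeRing.Carrier M → CommutativeRing.Carrier T)
         (E₂ : CommutativeRing.Carrier T) where
  private
    module M = CommutativeRing M
    module T = CommutativeRing T

  polyEval : List M.Carrier → T.Carrier
  polyEval []       = T.0#
  polyEval (a ∷ as) = ι a T.+ E₂ T.* polyEval as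

  record IsPolynomialRing : Set (c₁ ⊔ ℓ₁ ⊔ c₂ ⊔ ℓ₂) where
    field
      ι-isHom     : IsRingHom M T ι
      generated   : ∀ t → ∃ λ as → polyEval as T.≈ t
      independent : ∀ as → polyEval as T.≈ T.0# → All (M._≈ M.0#) as

module _ (M : CommutativeRing c ℓ) where
  open CommutativeRing M
  open RingOps M

  Ψ : (Carrier → Carrier) → Carrier → ℕ → Carrier
  Ψ ∂ E₄ zero          = 0#
  Ψ ∂ E₄ (suc zero)    = E₄
  Ψ ∂ E₄ (suc (suc j)) = ∂ (Ψ ∂ E₄ (suc j)) + ((suc j ℕ.* suc (suc j)) × (E₄ * Ψ ∂ E₄ j))

-- coefficient  (n+1)! (n+2)! / ( j! (j+1)! (n+1-j)! )   (an exact division)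

coeff : ℕ → ℕ → ℕ
coeff n j = ℕ._/_ ((suc n !) ℕ.* (suc (suc n) !)) ((j ! ℕ.* suc j !) ℕ.* (suc n ∸ j) !)
  {{m*n≢0 (j ! ℕ.* suc j !) ((suc n ∸ j) !) {{m*n≢0 (j !) (suc j !) {{j !≢0}} {{suc j !≢0}}}} {{(suc n ∸ j) !≢0}}}}

module Lemma6p2 {ℓg} (K : Field c₁ ℓ₁) (N : ℕ) (M : GradedAlgebra K N c₂ ℓ₂ ℓg)
                (∂ : GradedAlgebra.Carrier M → GradedAlgebra.Carrier M)
                (E₄ : GradedAlgebra.Carrier M)
                (T : CommutativeRing c₃ ℓ₃)
                (ι : GradedAlgebra.Carrier M → CommutativeRing.Carrier T)
                (E₂ : CommutativeRing.Carrier T)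
                (D : CommutativeRing.Carrier T → CommutativeRing.Carrier T) where
  private
    module K = Field K
    module M = GradedAlgebra M
    module T where
      open CommutativeRing T public
      open RingOps T public

  ηT : K.Carrier → T.Carrier
  ηT a = ι (M.η a)

  -- 𝒟 f = ∂f + k E₂ f  for f ∈ M_k,  k = m/N.
  -- The scalar k = m/N ∈ 𝕜 is the unique a with a·N = m in 𝕜.
  D-on-M : Set _
  D-on-M = ∀ (m : ℤ) (f : M.Carrier) (a : K.Carrier) →
             M.Gr m f → a K.* (N K.× K.1#) K.≈ K.intR m →
             D (ι f) T.≈ ι (∂ f) T.+ ηT a T.* E₂ T.* ι f

  D-on-E₂ : Set _
  D-on-E₂ = D E₂ T.≈ ι E₄ T.+ E₂ T.* E₂

  conclusion : ℕ → Set _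
  conclusion n =
    iterate D E₂ (suc n) T.≈
      T.sum≤ (suc n) (λ j → coeff n j T.× (E₂ T.^ (suc n ∸ j) T.* ι (Ψ M.cring ∂ E₄ j)))
      T.+ (suc n !) T.× (E₂ T.^ suc (suc n))

module Submission where

-- Write 𝒟ⁿ⁺¹E₂ as Σ_{a+j=n} L(n+2, j+2) E₂ᵃ Ψⱼ₊₁ + (n+1)! E₂ⁿ⁺², where L(n,k) are the unsigned
-- Lah numbers, and induct on n.  Since Ψⱼ₊₁ ∈ M_{2j+4}, 𝒟 sends E₂ᵃ Ψⱼ₊₁ to
-- (a + 2j + 4) E₂ᵃ⁺¹ Ψⱼ₊₁ + E₂ᵃ Ψⱼ₊₂ plus two E₄-terms: a E₂ᵃ⁻¹ E₄ Ψⱼ₊₁ from 𝒟E₂, and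
-- −(j+1)(j+2) E₂ᵃ E₄ Ψⱼ from ∂Ψⱼ₊₁.  The identity L(n,k)(n−k) = L(n,k+1) k(k+1) makes the
-- E₄-terms cancel along each antidiagonal a + j = n, and the Lah recurrence
-- L(n+1,k) = (n+k) L(n,k) + L(n,k−1) assembles the remaining ones (the boundary term with
-- L(n+2,1) = (n+2)! comes from 𝒟 of the power E₂ⁿ⁺²).  Finally, the coefficient
-- (n+1)!(n+2)!/(j!(j+1)!(n+1−j)!) of the statement is L(n+2, j+1).

open import Level using (Level)
open import Algebra.Bundles using (CommutativeMonoid; CommutativeRing; Monoid)
open import Algebra.Morphism.Structures using (module MonoidMorphisms; module RingMorphisms)
open import Data.Nat as ℕ using (ℕ; zero; suc; _!; _∸_; _≤_; z≤n; s≤s)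
import Data.Nat.Properties as ℕ
open import Data.Nat.GeneralisedArithmetic using (iterate)
open import Data.Nat.Tactic.RingSolver using (solve-∀)
open import Data.Integer using (+_)
open import Relation.Binary.PropositionalEquality as ≡ using (_≡_)
open import Defs
import Algebra.Definitions.RawMonoid as RawMonoidDefinitions
import Algebra.Properties.Monoid.Mult as MonoidMult
import Algebra.Properties.CommutativeMonoid.Mult as CommutativeMonoidMult
import Algebra.Properties.Semiring.Mult as SemiringMult
import Algebra.Properties.CommutativeSemigroup as CommutativeSemigroupProperties
import Algebra.Properties.Ring as RingProperties
import Relation.Binary.Reasoning.Setoid as SetoidReasoning

private variable c₁ ℓ₁ c₂ ℓ₂ c₃ ℓ₃ ℓg : Level

module Lah where
  open import Data.Nat
  open import Data.Nat.Properties
  open import Data.Nat.DivMod using (m*n/n≡m)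
  open import Relation.Binary.PropositionalEquality
  open ≡-Reasoning

  -- lah a j is the unsigned Lah number L(a + j + 1, j + 1).
  lah : ℕ → ℕ → ℕ
  lah zero    j       = 1
  lah (suc a) zero    = suc (suc a) !
  lah (suc a) (suc j) = lah a (suc j) * (a + 2 * suc (suc j)) + lah (suc a) j

  lah-closed-form : ∀ a j → lah a j * ((j ! * suc j !) * a !) ≡ (a + j) ! * suc (a + j) !
  lah-closed-form zero    j       = trans (*-identityˡ _) (*-identityʳ _)
  lah-closed-form (suc a) zero    = begin
    suc (suc a) ! * (1 * suc a !)       ≡⟨ cong (suc (suc a) ! *_) (*-identityˡ (suc a !)) ⟩
    suc (suc a) ! * suc a !             ≡⟨ *-comm (suc (suc a) !) (suc a !) ⟩
    suc a ! * suc (suc a) !             ≡⟨ cong (λ k → suc k ! * suc (suc k) !) (+-identityʳ a) ⟨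
    suc (a + 0) ! * suc (suc (a + 0)) ! ∎
  lah-closed-form (suc a) (suc j) = begin
    (lah a (suc j) * (a + 2 * suc (suc j)) + lah (suc a) j) * ((suc j ! * suc (suc j) !) * suc a !)
      ≡⟨ split a j (lah a (suc j)) (lah (suc a) j) (j !) (a !) ⟩
    (a + 2 * suc (suc j)) * suc a * (lah a (suc j) * ((suc j ! * suc (suc j) !) * a !))
      + suc j * suc (suc j) * (lah (suc a) j * ((j ! * suc j !) * suc a !))
      ≡⟨ cong₂ (λ x y → (a + 2 * suc (suc j)) * suc a * x + suc j * suc (suc j) * y)
               (lah-closed-form a (suc j))
               (trans (lah-closed-form (suc a) j) (cong (λ k → k ! * suc k !) (sym (+-suc a j)))) ⟩
    (a + 2 * suc (suc j)) * suc a * (m ! * suc m !) + suc j * suc (suc j) * (m ! * suc m !)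
      ≡⟨ combine a j (m !) ⟩
    suc m ! * suc (suc m) ! ∎
    where
    m = a + suc j
    split : ∀ a j L₁ L₂ J A →
      (L₁ * (a + 2 * suc (suc j)) + L₂) * ((suc j * J * (suc (suc j) * (suc j * J))) * (suc a * A))
        ≡ (a + 2 * suc (suc j)) * suc a * (L₁ * ((suc j * J * (suc (suc j) * (suc j * J))) * A))
          + suc j * suc (suc j) * (L₂ * ((J * (suc j * J)) * (suc a * A)))
    split = solve-∀
    combine : ∀ a j F →
      (a + 2 * suc (suc j)) * suc a * (F * (suc (a + suc j) * F))
        + suc j * suc (suc j) * (F * (suc (a + suc j) * F))
        ≡ suc (a + suc j) * F * (suc (suc (a + suc j)) * (suc (a + suc j) * F))
    combine = solve-∀

  lah-denominator≢0 : ∀ a j → NonZero ((j ! * suc j !) * a !)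
  lah-denominator≢0 a j = m*n≢0 _ _ {{j !* suc j !≢0}} {{a !≢0}}

  lah-ratio : ∀ a j → lah (suc a) j * suc a ≡ lah a (suc j) * (suc j * suc (suc j))
  lah-ratio a j = *-cancelʳ-≡ _ _ ((j ! * suc j !) * a !) {{lah-denominator≢0 a j}} (begin
    lah (suc a) j * suc a * ((j ! * suc j !) * a !)                  ≡⟨ move-suc-a a (lah (suc a) j) (j ! * suc j !) (a !) ⟩
    lah (suc a) j * ((j ! * suc j !) * suc a !)                      ≡⟨ lah-closed-form (suc a) j ⟩
    suc (a + j) ! * suc (suc (a + j)) !                              ≡⟨ cong (λ k → k ! * suc k !) (+-suc a j) ⟨
    (a + suc j) ! * suc (a + suc j) !                                ≡⟨ lah-closed-form a (suc j) ⟨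
    lah a (suc j) * ((suc j ! * suc (suc j) !) * a !)                ≡⟨ move-suc-j j (lah a (suc j)) (j !) (a !) ⟨
    lah a (suc j) * (suc j * suc (suc j)) * ((j ! * suc j !) * a !) ∎)
    where
    move-suc-a : ∀ a L J A → L * suc a * (J * A) ≡ L * (J * (suc a * A))
    move-suc-a = solve-∀
    move-suc-j : ∀ j L J A →
      L * (suc j * suc (suc j)) * ((J * (suc j * J)) * A) ≡ L * ((suc j * J * (suc (suc j) * (suc j * J))) * A)
    move-suc-j = solve-∀

  coeff≡lah : ∀ {n j} → j ≤ suc n → coeff n j ≡ lah (suc n ∸ j) j
  coeff≡lah {n} {j} j≤1+n = begin
    coeff n j                           ≡⟨ cong (_/ denominator) numerator≡ ⟨
    lah a j * denominator / denominator ≡⟨ m*n/n≡m (lah a j) denominator ⟩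
    lah a j                             ∎
    where
    a = suc n ∸ j
    denominator = (j ! * suc j !) * a !
    instance
      denominator≢0 : NonZero denominator
      denominator≢0 = lah-denominator≢0 a j
    numerator≡ : lah a j * denominator ≡ suc n ! * suc (suc n) !
    numerator≡ = trans (lah-closed-form a j) (cong (λ k → k ! * suc k !) (m∸n+n≡m j≤1+n))

open Lah using (lah; lah-ratio; coeff≡lah)

iterate-suc : ∀ {ℓ} {A : Set ℓ} (f : A → A) x n → iterate f x (suc n) ≡ f (iterate f x n)
iterate-suc f x zero    = ≡.refl
iterate-suc f x (suc n) = iterate-suc f (f x) n

module _ (M : Monoid c₁ ℓ₁) (N : Monoid c₂ ℓ₂) {h : Monoid.Carrier M → Monoid.Carrier N}
         (isHom : MonoidMorphisms.IsMonoidHomomorphism (Monoid.rawMonoid M) (Monoid.rawMonoid N) h) where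
  private
    module M where
      open Monoid M public
      open RawMonoidDefinitions rawMonoid public using (_×_)
    module N where
      open Monoid N public
      open RawMonoidDefinitions rawMonoid public using (_×_)
  open MonoidMorphisms.IsMonoidHomomorphism isHom using (homo; ε-homo)

  homo-× : ∀ n x → h (n M.× x) N.≈ n N.× h x
  homo-× zero    x = ε-homo
  homo-× (suc n) x = N.trans (homo x _) (N.∙-congˡ (homo-× n x))

module RingHomomorphismProperties (R : CommutativeRing c₁ ℓ₁) (S : CommutativeRing c₂ ℓ₂)
         {h : CommutativeRing.Carrier R → CommutativeRing.Carrier S} (isHom : IsRingHom R S h) where
  private
    module R where
      open CommutativeRing R public
      open RingOps R public
    module S where
      open CommutativeRing S public
      open RingOps S public
  open RingMorphisms.IsRingHomomorphism isHom using (+-isMonoidHomomorphism; 1#-homo)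

  homo-×1# : ∀ n → h (n R.× R.1#) S.≈ n S.× S.1#
  homo-×1# n = S.trans (homo-× R.+-monoid S.+-monoid +-isMonoidHomomorphism n R.1#)
                       (MonoidMult.×-congʳ S.+-monoid n 1#-homo)

module DerivationProperties {K : Field c₁ ℓ₁} {R : CommutativeRing c₂ ℓ₂}
                            {s : Field.Carrier K → CommutativeRing.Carrier R}
                            {D : CommutativeRing.Carrier R → CommutativeRing.Carrier R}
                            (isDerivation : IsDerivation {K = K} R s D) where
  open CommutativeRing R
  open RingOps R using (_×_; _^_)
  open IsDerivation isDerivation
  open RingProperties ring using (x+x≈x⇒x≈0)
  open SemiringMult semiring using (×-comm-*; ×-congʳ)
  open SetoidReasoning setoid

  D-0# : D 0# ≈ 0#
  D-0# = x+x≈x⇒x≈0 (D 0#) (trans (sym (additive 0# 0#)) (cong (+-identityʳ 0#)))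

  D-× : ∀ n x → D (n × x) ≈ n × D x
  D-× zero    x = D-0#
  D-× (suc n) x = trans (additive x (n × x)) (+-congˡ (D-× n x))

  D-^ : ∀ n x → D (x ^ suc n) ≈ suc n × (x ^ n * D x)
  D-^ zero    x = trans (cong (*-identityʳ x)) (sym (trans (+-identityʳ _) (*-identityˡ (D x))))
  D-^ (suc n) x = begin
    D (x * x ^ suc n)                              ≈⟨ leibniz x (x ^ suc n) ⟩
    D x * x ^ suc n + x * D (x ^ suc n)            ≈⟨ +-cong (*-comm (D x) _) (*-congˡ (D-^ n x)) ⟩
    x ^ suc n * D x + x * (suc n × (x ^ n * D x))  ≈⟨ +-congˡ (×-comm-* (suc n) x _) ⟩
    x ^ suc n * D x + suc n × (x * (x ^ n * D x))  ≈⟨ +-congˡ (×-congʳ (suc n) (*-assoc x _ _)) ⟨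
    suc (suc n) × (x ^ suc n * D x)                ∎

module AntidiagonalSum (M : CommutativeMonoid c₁ ℓ₁) where
  open CommutativeMonoid M
    renaming (_∙_ to _+_; ∙-cong to +-cong; ∙-congˡ to +-congˡ; ∙-congʳ to +-congʳ; assoc to +-assoc)
  open CommutativeSemigroupProperties commutativeSemigroup using (interchange)
  open SetoidReasoning setoid

  antidiagonalSum : ℕ → (ℕ → ℕ → Carrier) → Carrier
  antidiagonalSum zero    f = f 0 0
  antidiagonalSum (suc n) f = f (suc n) 0 + antidiagonalSum n (λ a j → f a (suc j))

  antidiagonalSum-cong : ∀ n {f g} → (∀ a j → f a j ≈ g a j) → antidiagonalSum n f ≈ antidiagonalSum n g
  antidiagonalSum-cong zero    f≈g = f≈g 0 0
  antidiagonalSum-cong (suc n) f≈g = +-cong (f≈g (suc n) 0) (antidiagonalSum-cong n (λ a j → f≈g a (suc j)))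

  antidiagonalSum-distrib : ∀ n f g →
    antidiagonalSum n (λ a j → f a j + g a j) ≈ antidiagonalSum n f + antidiagonalSum n g
  antidiagonalSum-distrib zero    f g = refl
  antidiagonalSum-distrib (suc n) f g =
    trans (+-congˡ (antidiagonalSum-distrib n _ _)) (interchange _ _ _ _)

  antidiagonalSum-homo : ∀ (h : Carrier → Carrier) → (∀ x y → h (x + y) ≈ h x + h y) →
    ∀ n f → h (antidiagonalSum n f) ≈ antidiagonalSum n (λ a j → h (f a j))
  antidiagonalSum-homo h h-+ zero    f = refl
  antidiagonalSum-homo h h-+ (suc n) f = trans (h-+ _ _) (+-congˡ (antidiagonalSum-homo h h-+ n _))

  antidiagonalSum-last : ∀ n f →
    antidiagonalSum (suc n) f ≈ antidiagonalSum n (λ a j → f (suc a) j) + f 0 (suc n)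
  antidiagonalSum-last zero    f = refl
  antidiagonalSum-last (suc n) f =
    trans (+-congˡ (antidiagonalSum-last n (λ a j → f a (suc j)))) (sym (+-assoc _ _ _))

  antidiagonalSum-shift : ∀ n f g → (∀ a j → f a (suc j) ≈ g (suc a) j) →
    antidiagonalSum n f + g 0 n ≈ f n 0 + antidiagonalSum n g
  antidiagonalSum-shift zero    f g f≈g = refl
  antidiagonalSum-shift (suc n) f g f≈g = begin
    f (suc n) 0 + antidiagonalSum n (λ a j → f a (suc j)) + g 0 (suc n)   ≈⟨ +-assoc _ _ _ ⟩
    f (suc n) 0 + (antidiagonalSum n (λ a j → f a (suc j)) + g 0 (suc n)) ≈⟨ +-congˡ (+-congʳ (antidiagonalSum-cong n f≈g)) ⟩
    f (suc n) 0 + (antidiagonalSum n (λ a j → g (suc a) j) + g 0 (suc n)) ≈⟨ +-congˡ (antidiagonalSum-last n g) ⟨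
    f (suc n) 0 + antidiagonalSum (suc n) g                               ∎

module AntidiagonalSum≈sum≤ (R : CommutativeRing c₁ ℓ₁) where
  open CommutativeRing R
  open RingOps R using (sum≤)
  open AntidiagonalSum +-commutativeMonoid using (antidiagonalSum)

  sum≤-cong : ∀ n {f g} → (∀ j → j ≤ n → f j ≈ g j) → sum≤ n f ≈ sum≤ n g
  sum≤-cong zero    f≈g = f≈g 0 z≤n
  sum≤-cong (suc n) f≈g = +-cong (sum≤-cong n (λ j j≤n → f≈g j (ℕ.m≤n⇒m≤1+n j≤n))) (f≈g (suc n) ℕ.≤-refl)

  sum≤-uncons : ∀ n f → sum≤ (suc n) f ≈ f 0 + sum≤ n (λ j → f (suc j))
  sum≤-uncons zero    f = refl
  sum≤-uncons (suc n) f = trans (+-congʳ (sum≤-uncons n f)) (+-assoc _ _ _)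

  antidiagonalSum≈sum≤ : ∀ n f → antidiagonalSum n f ≈ sum≤ n (λ j → f (n ∸ j) j)
  antidiagonalSum≈sum≤ zero    f = refl
  antidiagonalSum≈sum≤ (suc n) f = trans (+-congˡ (antidiagonalSum≈sum≤ n _)) (sym (sum≤-uncons n _))

module _ {K : Field c₁ ℓ₁} (T : CommutativeRing c₂ ℓ₂) where
  open CommutativeRing T
  open RingOps T

  -- P j stands for Ψⱼ and P 1 for E₄; D-P-recurrence is
  -- 𝒟Ψⱼ₊₁ = Ψⱼ₊₂ + (2j + 4) E₂ Ψⱼ₊₁ − (j + 1)(j + 2) E₄ Ψⱼ with the negative term moved across.
  module LahExpansion
    {s : Field.Carrier K → Carrier} {D : Carrier → Carrier}
    (isDerivation : IsDerivation {K = K} T s D)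
    (E : Carrier) (P : ℕ → Carrier)
    (P-0 : P 0 ≈ 0#)
    (D-E : D E ≈ P 1 + E * E)
    (D-P-recurrence : ∀ j → D (P (suc j)) + (suc j ℕ.* suc (suc j)) × (P 1 * P j)
                              ≈ P (suc (suc j)) + (2 ℕ.* suc (suc j)) × (E * P (suc j)))
    where

    open IsDerivation isDerivation using (leibniz; additive) renaming (cong to D-cong)
    open DerivationProperties isDerivation
    open AntidiagonalSum +-commutativeMonoid
    open MonoidMult +-monoid using (×-homo-+; ×-assocˡ; ×-congʳ; ×-congˡ)
    open CommutativeMonoidMult +-commutativeMonoid using (×-distrib-+)
    open CommutativeSemigroupProperties +-commutativeSemigroup using (interchange)
    open SemiringMult semiring using (×-comm-*; ×-assoc-*)
    open RingProperties ring using (+-cancelʳ)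
    open SetoidReasoning setoid

    ×-zeroʳ : ∀ n → n × 0# ≈ 0#
    ×-zeroʳ zero    = refl
    ×-zeroʳ (suc n) = trans (+-identityˡ _) (×-zeroʳ n)

    E^a*[E*x]≈E^[1+a]*x : ∀ a x → E ^ a * (E * x) ≈ E ^ suc a * x
    E^a*[E*x]≈E^[1+a]*x a x = trans (sym (*-assoc _ _ _)) (*-congʳ (*-comm _ _))

    D-E^ : ∀ a → D (E ^ suc a) ≈ suc a × (E ^ a * P 1) + suc a × E ^ suc (suc a)
    D-E^ a = begin
      D (E ^ suc a)                                     ≈⟨ D-^ a E ⟩
      suc a × (E ^ a * D E)                             ≈⟨ ×-congʳ (suc a) (*-congˡ D-E) ⟩
      suc a × (E ^ a * (P 1 + E * E))                   ≈⟨ ×-congʳ (suc a) (distribˡ _ _ _) ⟩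
      suc a × (E ^ a * P 1 + E ^ a * (E * E))           ≈⟨ ×-distrib-+ _ _ (suc a) ⟩
      suc a × (E ^ a * P 1) + suc a × (E ^ a * (E * E)) ≈⟨ +-congˡ (×-congʳ (suc a) E^a*E*E≈E^[2+a]) ⟩
      suc a × (E ^ a * P 1) + suc a × E ^ suc (suc a)   ∎
      where E^a*E*E≈E^[2+a] = trans (E^a*[E*x]≈E^[1+a]*x a E) (*-comm _ _)

    E-lowered-monomial : ℕ → ℕ → Carrier
    E-lowered-monomial zero    j = 0#
    E-lowered-monomial (suc a) j = suc a × (E ^ a * (P 1 * P (suc j)))

    D-monomial : ∀ a j →
      D (E ^ a * P (suc j)) + (suc j ℕ.* suc (suc j)) × (E ^ a * (P 1 * P j))
        ≈ ((a ℕ.+ 2 ℕ.* suc (suc j)) × (E ^ suc a * P (suc j)) + E ^ a * P (suc (suc j)))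
          + E-lowered-monomial a j
    D-monomial zero j = begin
      D (1# * Q) + m × (1# * (P 1 * P j))     ≈⟨ +-cong (D-cong (*-identityˡ Q)) (×-congʳ m (*-identityˡ _)) ⟩
      D Q + m × (P 1 * P j)                   ≈⟨ D-P-recurrence j ⟩
      P (suc (suc j)) + w × (E * Q)           ≈⟨ +-comm _ _ ⟩
      w × (E * Q) + P (suc (suc j))           ≈⟨ +-cong (×-congʳ w (*-congʳ (*-identityʳ E))) (*-identityˡ _) ⟨
      w × (E ^ 1 * Q) + 1# * P (suc (suc j))  ≈⟨ +-identityʳ _ ⟨
      (w × (E ^ 1 * Q) + 1# * P (suc (suc j))) + 0# ∎
      where
      Q = P (suc j)
      m = suc j ℕ.* suc (suc j)
      w = 2 ℕ.* suc (suc j)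
    D-monomial (suc a) j = begin
      D (E ^ suc a * Q) + m × (E ^ suc a * (P 1 * P j))
        ≈⟨ +-cong (leibniz _ _) (sym (×-comm-* m _ _)) ⟩
      (D (E ^ suc a) * Q + E ^ suc a * D Q) + E ^ suc a * (m × (P 1 * P j))
        ≈⟨ trans (+-assoc _ _ _) (+-congˡ (sym (distribˡ _ _ _))) ⟩
      D (E ^ suc a) * Q + E ^ suc a * (D Q + m × (P 1 * P j))
        ≈⟨ +-cong (*-congʳ (D-E^ a)) (*-congˡ (D-P-recurrence j)) ⟩
      (α × (E ^ a * P 1) + α × E ^ suc (suc a)) * Q + E ^ suc a * (P (suc (suc j)) + w × (E * Q))
        ≈⟨ +-cong (distribʳ _ _ _) (distribˡ _ _ _) ⟩
      ((α × (E ^ a * P 1)) * Q + (α × E ^ suc (suc a)) * Q) + (F + E ^ suc a * (w × (E * Q)))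
        ≈⟨ +-cong (+-cong (×-assoc-* α _ _) (×-assoc-* α _ _)) (+-congˡ (×-comm-* w _ _)) ⟩
      (α × ((E ^ a * P 1) * Q) + α × B) + (F + w × (E ^ suc a * (E * Q)))
        ≈⟨ +-cong (+-congʳ (×-congʳ α (*-assoc _ _ _))) (+-congˡ (×-congʳ w (E^a*[E*x]≈E^[1+a]*x (suc a) Q))) ⟩
      (α × L + α × B) + (F + w × B)
        ≈⟨ rearrange (α × L) (α × B) F (w × B) ⟩
      ((α × B + w × B) + F) + α × L
        ≈⟨ +-congʳ (+-congʳ (×-homo-+ B α w)) ⟨
      ((α ℕ.+ w) × B + F) + α × L ∎
      where
      Q = P (suc j)
      m = suc j ℕ.* suc (suc j)
      w = 2 ℕ.* suc (suc j)
      α = suc a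
      B = E ^ suc (suc a) * Q
      F = E ^ suc a * P (suc (suc j))
      L = E ^ a * (P 1 * Q)
      rearrange : ∀ x y z t → (x + y) + (z + t) ≈ ((y + t) + z) + x
      rearrange x y z t = begin
        (x + y) + (z + t) ≈⟨ interchange x y z t ⟩
        (x + z) + (y + t) ≈⟨ +-comm _ _ ⟩
        (y + t) + (x + z) ≈⟨ +-congˡ (+-comm x z) ⟩
        (y + t) + (z + x) ≈⟨ +-assoc _ _ _ ⟨
        ((y + t) + z) + x ∎

    lahTerm : ℕ → ℕ → Carrier
    lahTerm a j = lah a (suc j) × (E ^ a * P (suc j))

    lahExpansion : ℕ → Carrier
    lahExpansion n = antidiagonalSum n lahTerm + (suc n !) × E ^ suc (suc n)

    E-raised P-raised E-lowered P-lowered P-raised′ : ℕ → ℕ → Carrier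
    E-raised  a j = lah a (suc j) × ((a ℕ.+ 2 ℕ.* suc (suc j)) × (E ^ suc a * P (suc j)))
    P-raised  a j = lah a (suc j) × (E ^ a * P (suc (suc j)))
    E-lowered a j = lah a (suc j) × E-lowered-monomial a j
    P-lowered a j = lah a (suc j) × ((suc j ℕ.* suc (suc j)) × (E ^ a * (P 1 * P j)))
    P-raised′ a j = lah (suc a) j × (E ^ suc a * P (suc j))

    D-lahTerm : ∀ a j → D (lahTerm a j) + P-lowered a j ≈ (E-raised a j + P-raised a j) + E-lowered a j
    D-lahTerm a j = begin
      D (k × X) + k × C           ≈⟨ +-congʳ (D-× k X) ⟩
      k × D X + k × C             ≈⟨ ×-distrib-+ _ _ k ⟨
      k × (D X + C)               ≈⟨ ×-congʳ k (D-monomial a j) ⟩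
      k × ((A + B) + L)           ≈⟨ trans (×-distrib-+ _ _ k) (+-congʳ (×-distrib-+ _ _ k)) ⟩
      (k × A + k × B) + k × L     ∎
      where
      k = lah a (suc j)
      X = E ^ a * P (suc j)
      C = (suc j ℕ.* suc (suc j)) × (E ^ a * (P 1 * P j))
      A = (a ℕ.+ 2 ℕ.* suc (suc j)) × (E ^ suc a * P (suc j))
      B = E ^ a * P (suc (suc j))
      L = E-lowered-monomial a j

    E-lowered≈P-lowered : ∀ a j → E-lowered (suc a) j ≈ P-lowered a (suc j)
    E-lowered≈P-lowered a j = begin
      lah (suc a) (suc j) × (suc a × Y)                                ≈⟨ ×-assocˡ Y (lah (suc a) (suc j)) (suc a) ⟩
      (lah (suc a) (suc j) ℕ.* suc a) × Y                              ≡⟨ ≡.cong (_× Y) (lah-ratio a (suc j)) ⟩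
      (lah a (suc (suc j)) ℕ.* (suc (suc j) ℕ.* suc (suc (suc j)))) × Y ≈⟨ ×-assocˡ Y (lah a (suc (suc j))) _ ⟨
      P-lowered a (suc j)                                              ∎
      where Y = E ^ a * (P 1 * P (suc j))

    ∑E-lowered≈∑P-lowered : ∀ n → antidiagonalSum n E-lowered ≈ antidiagonalSum n P-lowered
    ∑E-lowered≈∑P-lowered n = begin
      antidiagonalSum n E-lowered                 ≈⟨ +-identityˡ _ ⟨
      0# + antidiagonalSum n E-lowered            ≈⟨ +-congʳ P-lowered-n-0≈0 ⟨
      P-lowered n 0 + antidiagonalSum n E-lowered ≈⟨ shift ⟨
      antidiagonalSum n P-lowered + E-lowered 0 n ≈⟨ +-congˡ (×-zeroʳ (lah 0 (suc n))) ⟩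
      antidiagonalSum n P-lowered + 0#            ≈⟨ +-identityʳ _ ⟩
      antidiagonalSum n P-lowered                 ∎
      where
      shift = antidiagonalSum-shift n P-lowered E-lowered (λ a j → sym (E-lowered≈P-lowered a j))
      P-lowered-n-0≈0 : P-lowered n 0 ≈ 0#
      P-lowered-n-0≈0 = begin
        lah n 1 × (2 × (E ^ n * (P 1 * P 0))) ≈⟨ ×-congʳ (lah n 1) (×-congʳ 2 (*-congˡ (trans (*-congˡ P-0) (zeroʳ _)))) ⟩
        lah n 1 × (2 × (E ^ n * 0#))          ≈⟨ ×-congʳ (lah n 1) (trans (×-congʳ 2 (zeroʳ _)) (×-zeroʳ 2)) ⟩
        lah n 1 × 0#                          ≈⟨ ×-zeroʳ (lah n 1) ⟩
        0#                                    ∎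

    ∑D-lahTerm : ∀ n → antidiagonalSum n (λ a j → D (lahTerm a j))
                         ≈ antidiagonalSum n E-raised + antidiagonalSum n P-raised
    ∑D-lahTerm n = +-cancelʳ (∑ P-lowered) _ _ (begin
      ∑ (λ a j → D (lahTerm a j)) + ∑ P-lowered                ≈⟨ antidiagonalSum-distrib n _ _ ⟨
      ∑ (λ a j → D (lahTerm a j) + P-lowered a j)              ≈⟨ antidiagonalSum-cong n D-lahTerm ⟩
      ∑ (λ a j → (E-raised a j + P-raised a j) + E-lowered a j) ≈⟨ antidiagonalSum-distrib n _ _ ⟩
      ∑ (λ a j → E-raised a j + P-raised a j) + ∑ E-lowered     ≈⟨ +-cong (antidiagonalSum-distrib n _ _) (∑E-lowered≈∑P-lowered n) ⟩
      (∑ E-raised + ∑ P-raised) + ∑ P-lowered                   ∎)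
      where ∑ = antidiagonalSum n

    lahTerm-suc : ∀ a j → lahTerm (suc a) j ≈ E-raised a j + P-raised′ a j
    lahTerm-suc a j = trans (×-homo-+ X (lah a (suc j) ℕ.* (a ℕ.+ 2 ℕ.* suc (suc j))) _)
                            (+-congʳ (sym (×-assocˡ X (lah a (suc j)) _)))
      where X = E ^ suc a * P (suc j)

    D-power : ∀ n → D ((suc n !) × E ^ suc (suc n))
                      ≈ (suc (suc n) !) × (E ^ suc n * P 1) + (suc (suc n) !) × E ^ suc (suc (suc n))
    D-power n = begin
      D (k × E ^ suc (suc n))        ≈⟨ D-× k _ ⟩
      k × D (E ^ suc (suc n))        ≈⟨ ×-congʳ k (D-E^ (suc n)) ⟩
      k × (m × A + m × B)            ≈⟨ ×-distrib-+ _ _ k ⟩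
      k × (m × A) + k × (m × B)      ≈⟨ +-cong (×-assocˡ A k m) (×-assocˡ B k m) ⟩
      (k ℕ.* m) × A + (k ℕ.* m) × B  ≈⟨ +-cong (×-congˡ (ℕ.*-comm k m)) (×-congˡ (ℕ.*-comm k m)) ⟩
      (m ℕ.* k) × A + (m ℕ.* k) × B  ∎
      where
      k = suc n !
      m = suc (suc n)
      A = E ^ suc n * P 1
      B = E ^ suc (suc (suc n))

    D-lahExpansion : ∀ n → D (lahExpansion n) ≈ lahExpansion (suc n)
    D-lahExpansion n = begin
      D (∑ n lahTerm + power)
        ≈⟨ additive _ _ ⟩
      D (∑ n lahTerm) + D power
        ≈⟨ +-cong (trans (antidiagonalSum-homo D additive n lahTerm) (∑D-lahTerm n)) (D-power n) ⟩
      (∑ n E-raised + ∑ n P-raised) + (P-raised′ n 0 + power′)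
        ≈⟨ regroup _ _ _ _ ⟩
      (∑ n E-raised + (P-raised′ n 0 + ∑ n P-raised)) + power′
        ≈⟨ +-congʳ (+-congˡ (antidiagonalSum-shift n P-raised′ P-raised (λ a j → refl))) ⟨
      (∑ n E-raised + (∑ n P-raised′ + P-raised 0 n)) + power′
        ≈⟨ +-congʳ (+-assoc _ _ _) ⟨
      ((∑ n E-raised + ∑ n P-raised′) + lahTerm 0 (suc n)) + power′
        ≈⟨ +-congʳ (+-congʳ (trans (antidiagonalSum-cong n lahTerm-suc) (antidiagonalSum-distrib n _ _))) ⟨
      (∑ n (λ a j → lahTerm (suc a) j) + lahTerm 0 (suc n)) + power′
        ≈⟨ +-congʳ (antidiagonalSum-last n lahTerm) ⟨
      ∑ (suc n) lahTerm + power′ ∎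
      where
      ∑ = antidiagonalSum
      power = (suc n !) × E ^ suc (suc n)
      power′ = (suc (suc n) !) × E ^ suc (suc (suc n))
      regroup : ∀ x y z t → (x + y) + (z + t) ≈ (x + (z + y)) + t
      regroup x y z t = begin
        (x + y) + (z + t) ≈⟨ +-assoc _ _ _ ⟨
        ((x + y) + z) + t ≈⟨ +-congʳ (+-assoc _ _ _) ⟩
        (x + (y + z)) + t ≈⟨ +-congʳ (+-congˡ (+-comm y z)) ⟩
        (x + (z + y)) + t ∎

    iterate-D-E : ∀ n → iterate D E (suc n) ≈ lahExpansion n
    iterate-D-E zero = begin
      D E                                    ≈⟨ D-E ⟩
      P 1 + E * E                            ≈⟨ +-cong (trans (+-identityʳ _) (*-identityˡ _))
                                                       (trans (+-identityʳ _) (*-congˡ (*-identityʳ E))) ⟨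
      1 × (1# * P 1) + 1 × (E * (E * 1#))    ∎
    iterate-D-E (suc n) = begin
      iterate D E (suc (suc n))  ≡⟨ iterate-suc D E (suc n) ⟩
      D (iterate D E (suc n))    ≈⟨ D-cong (iterate-D-E n) ⟩
      D (lahExpansion n)         ≈⟨ D-lahExpansion n ⟩
      lahExpansion (suc n)       ∎

    ∑lahTerm≈sum≤ : ∀ n → antidiagonalSum n lahTerm
                            ≈ sum≤ (suc n) (λ j → coeff n j × (E ^ (suc n ∸ j) * P j))
    ∑lahTerm≈sum≤ n = begin
      antidiagonalSum n lahTerm          ≈⟨ antidiagonalSum≈sum≤ n lahTerm ⟩
      sum≤ n (λ j → lahTerm (n ∸ j) j)   ≈⟨ sum≤-cong n lahTerm≈F[1+j] ⟩
      sum≤ n (λ j → F (suc j))           ≈⟨ +-identityˡ _ ⟨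
      0# + sum≤ n (λ j → F (suc j))      ≈⟨ +-congʳ F0≈0 ⟨
      F 0 + sum≤ n (λ j → F (suc j))     ≈⟨ sum≤-uncons n F ⟨
      sum≤ (suc n) F                     ∎
      where
      open AntidiagonalSum≈sum≤ T
      F = λ j → coeff n j × (E ^ (suc n ∸ j) * P j)
      lahTerm≈F[1+j] : ∀ j → j ≤ n → lahTerm (n ∸ j) j ≈ F (suc j)
      lahTerm≈F[1+j] j j≤n = reflexive (≡.cong (_× (E ^ (n ∸ j) * P (suc j))) (≡.sym (coeff≡lah (s≤s j≤n))))
      F0≈0 : F 0 ≈ 0#
      F0≈0 = trans (×-congʳ (coeff n 0) (trans (*-congˡ P-0) (zeroʳ _))) (×-zeroʳ (coeff n 0))

module _ {K : Field c₁ ℓ₁} {N : ℕ} (M : GradedAlgebra K N c₂ ℓ₂ ℓg) where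
  open GradedAlgebra M using (Gr; Gr-0; Gr-+; Gr-*; cring; _×_)

  Gr-× : ∀ {m x} k → Gr m x → Gr m (k × x)
  Gr-× zero    x∈Gr = Gr-0
  Gr-× (suc k) x∈Gr = Gr-+ x∈Gr (Gr-× k x∈Gr)

  Gr-cast : ∀ {m m′ x} → m ≡ m′ → Gr (+ m) x → Gr (+ m′) x
  Gr-cast ≡.refl x∈Gr = x∈Gr

  Ψ-homogeneous : ∀ {∂} → IsDerivationOfDegree2 M ∂ → ∀ {E₄} → Gr (+ (4 ℕ.* N)) E₄ →
                  ∀ j → Gr (+ (2 ℕ.* suc j ℕ.* N)) (Ψ cring ∂ E₄ j)
  Ψ-homogeneous ∂-deg2 E₄∈M₄ zero          = Gr-0
  Ψ-homogeneous ∂-deg2 E₄∈M₄ (suc zero)    = E₄∈M₄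
  Ψ-homogeneous ∂-deg2 E₄∈M₄ (suc (suc j)) =
    Gr-+ (Gr-cast (∂-weight j N) (degree2 (Ψ-homogeneous ∂-deg2 E₄∈M₄ (suc j))))
         (Gr-× (suc j ℕ.* suc (suc j)) (Gr-cast (E₄-weight j N) (Gr-* E₄∈M₄ (Ψ-homogeneous ∂-deg2 E₄∈M₄ j))))
    where
    open IsDerivationOfDegree2 ∂-deg2 using (degree2)
    ∂-weight : ∀ j N → 2 ℕ.* suc (suc j) ℕ.* N ℕ.+ 2 ℕ.* N ≡ 2 ℕ.* suc (suc (suc j)) ℕ.* N
    ∂-weight = solve-∀
    E₄-weight : ∀ j N → 4 ℕ.* N ℕ.+ 2 ℕ.* suc j ℕ.* N ≡ 2 ℕ.* suc (suc (suc j)) ℕ.* N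
    E₄-weight = solve-∀

module D-on-Ψ
  {K : Field c₁ ℓ₁} {N : ℕ} (M : GradedAlgebra K N c₂ ℓ₂ ℓg)
  {∂ : GradedAlgebra.Carrier M → GradedAlgebra.Carrier M} (∂-deg2 : IsDerivationOfDegree2 M ∂)
  {E₄ : GradedAlgebra.Carrier M} (E₄∈M₄ : GradedAlgebra.Gr M (+ (4 ℕ.* N)) E₄)
  (T : CommutativeRing c₃ ℓ₃)
  {ι : GradedAlgebra.Carrier M → CommutativeRing.Carrier T} (ι-isHom : IsRingHom (GradedAlgebra.cring M) T ι)
  (E₂ : CommutativeRing.Carrier T) (D : CommutativeRing.Carrier T → CommutativeRing.Carrier T)
  (D-on-M : Lemma6p2.D-on-M K N M ∂ E₄ T ι E₂ D)
  where
  private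
    module K = Field K
    module M = GradedAlgebra M
  open CommutativeRing T
  open RingOps T
  open RingMorphisms.IsRingHomomorphism ι-isHom
    using (0#-homo; +-homo; *-homo; +-isMonoidHomomorphism) renaming (⟦⟧-cong to ι-cong)
  open SemiringMult semiring using (×-assoc-*; ×-congʳ)
  open CommutativeSemigroupProperties +-commutativeSemigroup using (xy∙z≈xz∙y)
  open Lemma6p2 K N M ∂ E₄ T ι E₂ D using (ηT)
  open SetoidReasoning setoid

  P : ℕ → Carrier
  P j = ι (Ψ M.cring ∂ E₄ j)

  P-0 : P 0 ≈ 0#
  P-0 = 0#-homo

  ηT-×1# : ∀ n → ηT (n K.× K.1#) ≈ n × 1#
  ηT-×1# n = trans (ι-cong (RingHomomorphismProperties.homo-×1# K.commutativeRing M.cring M.η-isHom n))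
                   (RingHomomorphismProperties.homo-×1# M.cring T ι-isHom n)

  D-P : ∀ j → D (P j) ≈ ι (∂ (Ψ M.cring ∂ E₄ j)) + (2 ℕ.* suc j) × (E₂ * P j)
  D-P j = begin
    D (P j)                          ≈⟨ D-on-M _ _ w (Ψ-homogeneous M ∂-deg2 E₄∈M₄ j) w*N≈2[1+j]N ⟩
    ι (∂ Ψⱼ) + ηT w * E₂ * P j       ≈⟨ +-congˡ (*-congʳ (*-congʳ (ηT-×1# k))) ⟩
    ι (∂ Ψⱼ) + k × 1# * E₂ * P j     ≈⟨ +-congˡ (*-congʳ (trans (×-assoc-* k 1# E₂) (×-congʳ k (*-identityˡ E₂)))) ⟩
    ι (∂ Ψⱼ) + k × E₂ * P j          ≈⟨ +-congˡ (×-assoc-* k E₂ (P j)) ⟩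
    ι (∂ Ψⱼ) + k × (E₂ * P j)        ∎
    where
    Ψⱼ = Ψ M.cring ∂ E₄ j
    k = 2 ℕ.* suc j
    w = k K.× K.1#
    w*N≈2[1+j]N : w K.* (N K.× K.1#) K.≈ K.intR (+ (k ℕ.* N))
    w*N≈2[1+j]N = K.sym (SemiringMult.×1-homo-* K.semiring k N)

  P-suc-suc : ∀ j → P (suc (suc j)) ≈ ι (∂ (Ψ M.cring ∂ E₄ (suc j))) + (suc j ℕ.* suc (suc j)) × (P 1 * P j)
  P-suc-suc j = trans (+-homo _ _) (+-congˡ (trans (homo-× M.+-monoid +-monoid +-isMonoidHomomorphism m (E₄ M.* Ψⱼ))
                                                   (×-congʳ m (*-homo E₄ Ψⱼ))))
    where
    Ψⱼ = Ψ M.cring ∂ E₄ j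
    m = suc j ℕ.* suc (suc j)

  D-P-recurrence : ∀ j → D (P (suc j)) + (suc j ℕ.* suc (suc j)) × (P 1 * P j)
                           ≈ P (suc (suc j)) + (2 ℕ.* suc (suc j)) × (E₂ * P (suc j))
  D-P-recurrence j = begin
    D (P (suc j)) + m × (P 1 * P j)                        ≈⟨ +-congʳ (D-P (suc j)) ⟩
    (ι (∂ Ψⱼ₊₁) + w × (E₂ * P (suc j))) + m × (P 1 * P j)  ≈⟨ xy∙z≈xz∙y _ _ _ ⟩
    (ι (∂ Ψⱼ₊₁) + m × (P 1 * P j)) + w × (E₂ * P (suc j))  ≈⟨ +-congʳ (P-suc-suc j) ⟨
    P (suc (suc j)) + w × (E₂ * P (suc j))                 ∎
    where
    Ψⱼ₊₁ = Ψ M.cring ∂ E₄ (suc j)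
    m = suc j ℕ.* suc (suc j)
    w = 2 ℕ.* suc (suc j)

open import Data.Nat using (ℕ; _<_; _*_)

lemma6p2 : ∀ {c₁ ℓ₁ c₂ ℓ₂ ℓg c₃ ℓ₃ : Level}
             (K : Field c₁ ℓ₁) → CharacteristicZero K →
             (N : ℕ) → 0 < N →
             (M : GradedAlgebra K N c₂ ℓ₂ ℓg) →
             (∂ : GradedAlgebra.Carrier M → GradedAlgebra.Carrier M) →
             IsDerivationOfDegree2 M ∂ →
             (E₄ : GradedAlgebra.Carrier M) → GradedAlgebra.Gr M (+ (4 * N)) E₄ →
             (T : CommutativeRing c₃ ℓ₃) →
             (ι : GradedAlgebra.Carrier M → CommutativeRing.Carrier T) →
             (E₂ : CommutativeRing.Carrier T) →
             IsPolynomialRing (GradedAlgebra.cring M) T ι E₂ →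
             (D : CommutativeRing.Carrier T → CommutativeRing.Carrier T) →
             IsDerivation {K = K} T (Lemma6p2.ηT K N M ∂ E₄ T ι E₂ D) D →
             Lemma6p2.D-on-M K N M ∂ E₄ T ι E₂ D →
             Lemma6p2.D-on-E₂ K N M ∂ E₄ T ι E₂ D →
             (n : ℕ) → Lemma6p2.conclusion K N M ∂ E₄ T ι E₂ D n
lemma6p2 _ _ _ _ M _ ∂-deg2 _ E₄∈M₄ T _ E₂ isPolynomialRing D D-isDerivation D-on-M D-on-E₂ n =
  trans (iterate-D-E n) (+-congʳ (∑lahTerm≈sum≤ n))
  where
  open CommutativeRing T using (trans; +-congʳ)
  open D-on-Ψ M ∂-deg2 E₄∈M₄ T (IsPolynomialRing.ι-isHom isPolynomialRing) E₂ D D-on-M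
  open LahExpansion T D-isDerivation E₂ P P-0 D-on-E₂ D-P-recurrence
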